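{- Let $g \notin \{ -1,1\}$ be an odd integer and let $w$ be a non-zero integer. Then $$\sum_{k=1}^{\omega_g(2^n)} e^{2\pi i w g^k/2^n} = 0$$ for every integer $n \ge d(w) + \max\{3, c(g)\}$.
   Context: For an odd integer $g$ and a positive integer $m$, $\omega_g(2^m)=\min\{k\in\mathbb{N} : g^k \equiv 1 \pmod{2^m}\}$ is the multiplicative order of $g$ modulo $2^m$ ($\mathbb{N}=\{1,2,\dots\}$). For a non-zero integer $w$, $d(w)=\max\{k \in \mathbb{N}_0 : 2^k \mid w\}$ is the exponent of the largest power of $2$ dividing $w$. For an odd integer $g \notin\{ -1,1\}$, $c(g)=\min\{k\in\mathbb{N} : g < 2^{k-1}-1\}$ if $g>1$, and $c(g)=\min\{k\in\mathbb{N} : g > -2^{k-1}-1\}$ if $g<-1$. -}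

module Defs where

open import Data.Nat as ℕ using (ℕ; zero; suc; _<_; _≤_; _⊔_)
open import Data.Nat.Properties using (m^n≢0)
open import Data.Integer as ℤ using (ℤ; +_; -_; _*_; _-_; _%ℕ_)
open import Data.Integer.Divisibility using (_∣_)
open import Data.Product using (_×_)
open import Relation.Nullary using (¬_)
open import Relation.Binary.PropositionalEquality using (_≡_)
open import Data.Bool using (if_then_else_)
open import Relation.Nullary.Decidable using (⌊_⌋)

pow2 : ℕ → ℕ
pow2 m = 2 ℕ.^ m

pow2ℤ : ℕ → ℤ
pow2ℤ m = + (pow2 m)

IsMultOrder2 : ℤ → ℕ → ℕ → Set
IsMultOrder2 g m K =
  (1 ≤ K) × (pow2ℤ m ∣ (g ℤ.^ K - + 1))
  × (∀ j → 1 ≤ j → j < K → ¬ (pow2ℤ m ∣ (g ℤ.^ j - + 1)))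

Is2Adic : ℤ → ℕ → Set
Is2Adic w D = (pow2ℤ D ∣ w) × ¬ (pow2ℤ (suc D) ∣ w)

cCond : ℤ → ℕ → Set
cCond g k with g ℤ.<? + 0
... | Relation.Nullary.no _  = g ℤ.< pow2ℤ (k ℕ.∸ 1) - + 1
... | Relation.Nullary.yes _ = g ℤ.> - pow2ℤ (k ℕ.∸ 1) - + 1

IsC : ℤ → ℕ → Set
IsC g C = (1 ≤ C) × cCond g C × (∀ k → 1 ≤ k → k < C → ¬ cCond g k)

-- Exact model of the cyclotomic ring ℤ[ζ], ζ = e^{2πi/2^n} (n ≥ 1), as
-- ℤ[x]/(x^{2^{n-1}} + 1), with ℤ-basis 1, ζ, …, ζ^{2^{n-1}-1}.
-- An element is given by its coefficient function (only indices i < 2^{n-1}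
-- are meaningful).
Cyc : Set
Cyc = ℕ → ℤ

-- ζ^a = e^{2πi a/2^n}: with r = a mod 2^n, it is +ζ^r if r < 2^{n-1},
-- and -ζ^{r - 2^{n-1}} otherwise (since ζ^{2^{n-1}} = -1).
zetaPow : (n : ℕ) → ℤ → Cyc
zetaPow n a i =
  let r = _%ℕ_ a (pow2 n) {{m^n≢0 2 n}} in
  if ⌊ r ℕ.≟ i ⌋ then + 1
  else if ⌊ r ℕ.≟ i ℕ.+ pow2 (n ℕ.∸ 1) ⌋ then - + 1
  else + 0

zeroC : Cyc
zeroC i = + 0

_⊕_ : Cyc → Cyc → Cyc
(x ⊕ y) i = x i ℤ.+ y i

sumFrom1 : ℕ → (ℕ → Cyc) → Cyc
sumFrom1 zero f = zeroC
sumFrom1 (suc K) f = sumFrom1 K f ⊕ f (suc K)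

IsZeroCyc : ℕ → Cyc → Set
IsZeroCyc n x = ∀ i → i < pow2 (n ℕ.∸ 1) → x i ≡ + 0

{-# OPTIONS --safe #-}
module Submission where

-- Write n = d(w) + M + 1 and w = 2^d(w) · odd.  Since |g + 1| < 2^(c(g) - 1) ≤ 2^M,
-- the exact power of 2 dividing g - 1 (if g ≡ 1 mod 4) or g² - 1 (if g ≡ 3 mod 4) is
-- 2^a with 2 ≤ a ≤ M.  Squaring raises that exponent by exactly one, so some power
-- satisfies g^j = 1 + 2^M · odd.  Then w g^(j+k) ≡ w g^k + 2^(n-1) (mod 2^n), i.e.
-- ζ^(w g^(j+k)) = -ζ^(w g^k).  As K is a period of k ↦ g^k mod 2^n, shifting the
-- summation index by j leaves the sum S unchanged, so S = -S and S = 0.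

open import Defs
open import Data.Bool using (if_then_else_)
open import Data.Integer as ℤ using (ℤ; +_; -[1+_]; _*_; _-_; -_; _^_; ∣_∣; _%ℕ_; _/ℕ_) renaming (_+_ to _+ℤ_)
import Data.Integer.Properties as ℤ
open import Data.Integer.DivMod using (a≡a%ℕn+[a/ℕn]*n; n%ℕd<d)
open import Data.Integer.Divisibility using (_∣_)
open import Data.Integer.Divisibility.Signed as Signed using (divides; ∣ᵤ⇒∣; ∣⇒∣ᵤ)
open import Data.Integer.Tactic.RingSolver using (solve-∀)
open import Data.Nat as ℕ using (ℕ; zero; suc; _≤_; _<_; _+_; _∸_; _⊔_; z≤n; s≤s; NonZero)
import Data.Nat.Properties as ℕ
open import Data.Nat.DivMod using (_%_; m<n⇒m%n≡m; [m+n]%n≡m%n)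
open import Data.Nat.Induction using (<-wellFounded)
open import Data.Product using (∃-syntax; _×_; _,_)
open import Data.Sum using (_⊎_; inj₁; inj₂)
open import Function using (_∘_)
open import Induction.WellFounded using (Acc; acc)
open import Relation.Binary.PropositionalEquality
open import Relation.Nullary using (¬_; yes; no; contradiction)
open import Relation.Nullary.Decidable using (⌊_⌋)
open import Algebra.Properties.AbelianGroup ℤ.+-0-abelianGroup using (quasigroup)
open import Algebra.Properties.Quasigroup quasigroup using (cancelʳ)

pow2≢0 : ∀ m → NonZero (pow2 m)
pow2≢0 m = ℕ.m^n≢0 2 m

pow2-suc : ∀ m → pow2 (suc m) ≡ pow2 m + pow2 m
pow2-suc m = cong (_+_ (pow2 m)) (ℕ.+-identityʳ (pow2 m))

pow2ℤ-suc : ∀ m → pow2ℤ (suc m) ≡ + 2 * pow2ℤ m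
pow2ℤ-suc m = ℤ.pos-* 2 (pow2 m)

pow2ℤ-+ : ∀ a b → pow2ℤ (a + b) ≡ pow2ℤ a * pow2ℤ b
pow2ℤ-+ a b = trans (cong +_ (ℕ.^-distribˡ-+-* 2 a b)) (ℤ.pos-* (pow2 a) (pow2 b))

infix 4 _≡_[mod_]

record _≡_[mod_] (a b : ℤ) (d : ℕ) : Set where
  constructor withQuotient
  field
    quotient : ℤ
    equality : a ≡ b +ℤ quotient * + d

+-congˡ-mod : ∀ {a b d} c → a ≡ b [mod d ] → c +ℤ a ≡ c +ℤ b [mod d ]
+-congˡ-mod {a} {b} {d} c (withQuotient q refl) = withQuotient q (shift c b q (+ d))
  where
  shift : ∀ c b q d → c +ℤ (b +ℤ q * d) ≡ c +ℤ b +ℤ q * d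
  shift = solve-∀

*-congˡ-mod : ∀ {a b d} c → a ≡ b [mod d ] → c * a ≡ c * b [mod d ]
*-congˡ-mod {a} {b} {d} c (withQuotient q refl) = withQuotient (c * q) (distrib c b q (+ d))
  where
  distrib : ∀ c b q d → c * (b +ℤ q * d) ≡ c * b +ℤ c * q * d
  distrib = solve-∀

∣⇒≡[mod] : ∀ {a b d} → + d ∣ (a - b) → a ≡ b [mod d ]
∣⇒≡[mod] {a} {b} d∣a-b with ∣ᵤ⇒∣ d∣a-b
... | divides q a-b≡qd = withQuotient q (trans (sym (restore a b)) (cong (b +ℤ_) a-b≡qd))
  where
  restore : ∀ a b → b +ℤ (a - b) ≡ a
  restore = solve-∀

≡[mod]-<⇒≡ : ∀ {d r s} → r < d → s < d → + r ≡ + s [mod d ] → r ≡ s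
≡[mod]-<⇒≡ {d} {r} {s} r<d s<d (withQuotient q r≡s+qd) with q ℤ.≟ + 0
... | yes refl = trans (ℤ.+-injective r≡s+qd) (ℕ.+-identityʳ s)
... | no q≢0  = contradiction d≤∣r⊖s∣ (ℕ.<⇒≱ ∣r⊖s∣<d)
  where
  ∣r⊖s∣≡∣q∣d : ∣ r ℤ.⊖ s ∣ ≡ ∣ q ∣ ℕ.* d
  ∣r⊖s∣≡∣q∣d = begin
    ∣ r ℤ.⊖ s ∣              ≡⟨ cong ∣_∣ (ℤ.m-n≡m⊖n r s) ⟨
    ∣ + r - + s ∣            ≡⟨ cong (λ x → ∣ x - + s ∣) r≡s+qd ⟩
    ∣ + s +ℤ q * + d - + s ∣ ≡⟨ cong ∣_∣ (cancel (+ s) (q * + d)) ⟩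
    ∣ q * + d ∣              ≡⟨ ℤ.abs-* q (+ d) ⟩
    ∣ q ∣ ℕ.* d              ∎
    where
    open ≡-Reasoning
    cancel : ∀ s x → s +ℤ x - s ≡ x
    cancel = solve-∀
  d≤∣r⊖s∣ : d ≤ ∣ r ℤ.⊖ s ∣
  d≤∣r⊖s∣ = subst (d ≤_) (sym ∣r⊖s∣≡∣q∣d) (ℕ.m≤n*m d ∣ q ∣ {{ℤ.≢-nonZero q≢0}})
  ∣r⊖s∣<d : ∣ r ℤ.⊖ s ∣ < d
  ∣r⊖s∣<d = ℕ.≤-<-trans (ℤ.∣m⊝n∣≤m⊔n r s) (ℕ.⊔-lub r<d s<d)

%ℕ-cong : ∀ d .{{_ : NonZero d}} {a b} → a ≡ b [mod d ] → a %ℕ d ≡ b %ℕ d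
%ℕ-cong d {a} {b} (withQuotient q a≡b+qd) =
  ≡[mod]-<⇒≡ (n%ℕd<d a d) (n%ℕd<d b d) (withQuotient (q +ℤ b /ℕ d - a /ℕ d) (begin
    + (a %ℕ d)                                ≡⟨ isolate (+ (a %ℕ d)) (a /ℕ d) (+ d) ⟩
    + (a %ℕ d) +ℤ a /ℕ d * + d - a /ℕ d * + d ≡⟨ cong (λ x → x - a /ℕ d * + d) (sym (a≡a%ℕn+[a/ℕn]*n a d)) ⟩
    a - a /ℕ d * + d                          ≡⟨ cong (λ x → x - a /ℕ d * + d) a≡b+qd ⟩
    b +ℤ q * + d - a /ℕ d * + d               ≡⟨ cong (λ x → x +ℤ q * + d - a /ℕ d * + d) (a≡a%ℕn+[a/ℕn]*n b d) ⟩
    + (b %ℕ d) +ℤ b /ℕ d * + d +ℤ q * + d - a /ℕ d * + d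
                                              ≡⟨ collect (+ (b %ℕ d)) (b /ℕ d) q (a /ℕ d) (+ d) ⟩
    + (b %ℕ d) +ℤ (q +ℤ b /ℕ d - a /ℕ d) * + d ∎))
  where
  open ≡-Reasoning
  isolate : ∀ r q d → r ≡ r +ℤ q * d - q * d
  isolate = solve-∀
  collect : ∀ r p q s d → r +ℤ p * d +ℤ q * d - s * d ≡ r +ℤ (q +ℤ p - s) * d
  collect = solve-∀

-- Coordinates of powers of ζ

-- the body of zetaPow, as a function of the remainder r = a mod 2^n (with N = 2^(n-1))
zetaCoeff : ℕ → ℕ → ℕ → ℤ
zetaCoeff N r i = if ⌊ r ℕ.≟ i ⌋ then + 1 else if ⌊ r ℕ.≟ i + N ⌋ then - + 1 else + 0

zetaPow-cong : ∀ n {a b} → a ≡ b [mod pow2 n ] → ∀ i → zetaPow n a i ≡ zetaPow n b i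
zetaPow-cong n a≡b i = cong (λ r → zetaCoeff (pow2 (n ∸ 1)) r i) (%ℕ-cong (pow2 n) {{pow2≢0 n}} a≡b)

zetaCoeff-+N : ∀ {N s i} → s < N → i < N → zetaCoeff N (s + N) i ≡ - zetaCoeff N s i
zetaCoeff-+N {N} {s} {i} s<N i<N with s + N ℕ.≟ i | s ℕ.≟ i + N | s ℕ.≟ i | s + N ℕ.≟ i + N
... | yes s+N≡i | _ | _ | _ = contradiction (subst (N ≤_) s+N≡i (ℕ.m≤n+m N s)) (ℕ.<⇒≱ i<N)
... | _ | yes s≡i+N | _ | _ = contradiction (subst (N ≤_) (sym s≡i+N) (ℕ.m≤n+m N i)) (ℕ.<⇒≱ s<N)
... | no _ | no _ | yes _   | yes _        = refl
... | no _ | no _ | yes s≡i | no s+N≢i+N   = contradiction (cong (_+ N) s≡i) s+N≢i+N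
... | no _ | no _ | no s≢i  | yes s+N≡i+N = contradiction (ℕ.+-cancelʳ-≡ N s i s+N≡i+N) s≢i
... | no _ | no _ | no _    | no _         = refl

zetaCoeff-half-turn : ∀ {N d r i} .{{_ : NonZero d}} → d ≡ N + N → r < d → i < N →
  zetaCoeff N ((r + N) % d) i ≡ - zetaCoeff N r i
zetaCoeff-half-turn {N} {d} {r} {i} d≡2N r<d i<N with r ℕ.<? N
... | yes r<N = begin
  zetaCoeff N ((r + N) % d) i ≡⟨ cong (λ x → zetaCoeff N x i) (m<n⇒m%n≡m r+N<d) ⟩
  zetaCoeff N (r + N) i       ≡⟨ zetaCoeff-+N r<N i<N ⟩
  - zetaCoeff N r i           ∎
  where
  open ≡-Reasoning
  r+N<d : r + N < d
  r+N<d = subst (r + N <_) (sym d≡2N) (ℕ.+-monoˡ-< N r<N)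
... | no r≮N = begin
  zetaCoeff N ((r + N) % d) i ≡⟨ cong (λ x → zetaCoeff N (x % d) i) r+N≡s+d ⟩
  zetaCoeff N ((s + d) % d) i ≡⟨ cong (λ x → zetaCoeff N x i) ([m+n]%n≡m%n s d) ⟩
  zetaCoeff N (s % d) i       ≡⟨ cong (λ x → zetaCoeff N x i) (m<n⇒m%n≡m s<d) ⟩
  zetaCoeff N s i             ≡⟨ ℤ.neg-involutive _ ⟨
  - - zetaCoeff N s i         ≡⟨ cong -_ (zetaCoeff-+N s<N i<N) ⟨
  - zetaCoeff N (s + N) i     ≡⟨ cong (λ x → - zetaCoeff N x i) s+N≡r ⟩
  - zetaCoeff N r i           ∎
  where
  open ≡-Reasoning
  s = r ∸ N
  s+N≡r : s + N ≡ r
  s+N≡r = ℕ.m∸n+n≡m (ℕ.≮⇒≥ r≮N)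
  s<N : s < N
  s<N = ℕ.+-cancelʳ-< N s N (subst₂ _<_ (sym s+N≡r) d≡2N r<d)
  s<d : s < d
  s<d = subst (s <_) (sym d≡2N) (ℕ.<-≤-trans s<N (ℕ.m≤m+n N N))
  r+N≡s+d : r + N ≡ s + d
  r+N≡s+d = trans (cong (_+ N) (sym s+N≡r)) (trans (ℕ.+-assoc s N N) (cong (_+_ s) (sym d≡2N)))

zetaPow-half-turn : ∀ M a {i} → i < pow2 M → zetaPow (suc M) (a +ℤ pow2ℤ M) i ≡ - zetaPow (suc M) a i
zetaPow-half-turn M a {i} i<N = begin
  zetaPow (suc M) (a +ℤ pow2ℤ M) i   ≡⟨ zetaPow-cong (suc M) {b = + (r + pow2 M)} (withQuotient q a+N≡r+N+qd) i ⟩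
  zetaPow (suc M) (+ (r + pow2 M)) i ≡⟨ zetaCoeff-half-turn (pow2-suc M) (n%ℕd<d a (pow2 (suc M))) i<N ⟩
  - zetaPow (suc M) a i              ∎
  where
  open ≡-Reasoning
  instance
    _ : NonZero (pow2 (suc M))
    _ = pow2≢0 (suc M)
  r = a %ℕ pow2 (suc M)
  q = a /ℕ pow2 (suc M)
  a+N≡r+N+qd : a +ℤ pow2ℤ M ≡ + (r + pow2 M) +ℤ q * pow2ℤ (suc M)
  a+N≡r+N+qd = begin
    a +ℤ pow2ℤ M                        ≡⟨ cong (_+ℤ pow2ℤ M) (a≡a%ℕn+[a/ℕn]*n a (pow2 (suc M))) ⟩
    + r +ℤ q * pow2ℤ (suc M) +ℤ pow2ℤ M ≡⟨ swap (+ r) (q * pow2ℤ (suc M)) (pow2ℤ M) ⟩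
    + r +ℤ pow2ℤ M +ℤ q * pow2ℤ (suc M) ≡⟨ cong (_+ℤ q * pow2ℤ (suc M)) (ℤ.pos-+ r (pow2 M)) ⟨
    + (r + pow2 M) +ℤ q * pow2ℤ (suc M) ∎
    where
    swap : ∀ x y z → x +ℤ y +ℤ z ≡ x +ℤ z +ℤ y
    swap = solve-∀

x≡-x⇒x≡0 : ∀ {x} → x ≡ - x → x ≡ + 0
x≡-x⇒x≡0 {+ zero}    _  = refl
x≡-x⇒x≡0 {+ suc _}   ()
x≡-x⇒x≡0 { -[1+ _ ]} ()

sumFrom1-neg : ∀ K {f h : ℕ → Cyc} {i} → (∀ k → f k i ≡ - h k i) → sumFrom1 K f i ≡ - sumFrom1 K h i
sumFrom1-neg zero    f≡-h = refl
sumFrom1-neg (suc K) {f} {h} {i} f≡-h = begin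
  sumFrom1 K f i +ℤ f (suc K) i       ≡⟨ cong₂ _+ℤ_ (sumFrom1-neg K f≡-h) (f≡-h (suc K)) ⟩
  - sumFrom1 K h i +ℤ - h (suc K) i   ≡⟨ ℤ.neg-distrib-+ (sumFrom1 K h i) (h (suc K) i) ⟨
  - (sumFrom1 K h i +ℤ h (suc K) i)   ∎
  where open ≡-Reasoning

sumFrom1-suc : ∀ K (f : ℕ → Cyc) i → sumFrom1 K (f ∘ suc) i +ℤ f 1 i ≡ sumFrom1 K f i +ℤ f (suc K) i
sumFrom1-suc zero    f i = refl
sumFrom1-suc (suc K) f i = begin
  sumFrom1 K (f ∘ suc) i +ℤ f (2 + K) i +ℤ f 1 i ≡⟨ swap (sumFrom1 K (f ∘ suc) i) (f (2 + K) i) (f 1 i) ⟩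
  sumFrom1 K (f ∘ suc) i +ℤ f 1 i +ℤ f (2 + K) i ≡⟨ cong (_+ℤ f (2 + K) i) (sumFrom1-suc K f i) ⟩
  sumFrom1 K f i +ℤ f (suc K) i +ℤ f (2 + K) i   ∎
  where
  open ≡-Reasoning
  swap : ∀ x y z → x +ℤ y +ℤ z ≡ x +ℤ z +ℤ y
  swap = solve-∀

sumFrom1-rotate : ∀ K (f : ℕ → Cyc) i → (∀ k → f (k + K) i ≡ f k i) →
  ∀ j → sumFrom1 K (λ k → f (j + k)) i ≡ sumFrom1 K f i
sumFrom1-rotate K f i periodic zero    = refl
sumFrom1-rotate K f i periodic (suc j) = trans (sumFrom1-rotate K (f ∘ suc) i (periodic ∘ suc) j) rotate-once
  where
  rotate-once : sumFrom1 K (f ∘ suc) i ≡ sumFrom1 K f i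
  rotate-once = cancelʳ (f 1 i) _ _ (trans (sumFrom1-suc K f i) (cong (sumFrom1 K f i +ℤ_) (periodic 1)))

-- Odd numbers and exact powers of two

Odd : ℤ → Set
Odd x = ∃[ t ] x ≡ + 1 +ℤ t * + 2

infix 4 2^_∥_

record 2^_∥_ (m : ℕ) (x : ℤ) : Set where
  constructor odd·2^
  field
    oddPart     : ℤ
    oddPart-odd : Odd oddPart
    equality    : x ≡ oddPart * pow2ℤ m

parity : ∀ x → Signed._∣_ (+ 2) x ⊎ Odd x
parity x with x %ℕ 2 | a≡a%ℕn+[a/ℕn]*n x 2 | n%ℕd<d x 2
... | 0           | x≡0+q2 | _ = inj₁ (divides (x /ℕ 2) (trans x≡0+q2 (ℤ.+-identityˡ _)))
... | 1           | x≡1+q2 | _ = inj₂ (x /ℕ 2 , x≡1+q2)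
... | suc (suc _) | _      | s≤s (s≤s ())

¬2∣⇒Odd : ∀ {x} → ¬ (+ 2 ∣ x) → Odd x
¬2∣⇒Odd {x} 2∤x with parity x
... | inj₁ 2∣x   = contradiction (∣⇒∣ᵤ 2∣x) 2∤x
... | inj₂ x-odd = x-odd

Odd⇒≢0 : ∀ {x} → Odd x → x ≢ + 0
Odd⇒≢0 (t , refl) 1+2t≡0 with trans (sym (%ℕ-cong 2 {b = + 1} (withQuotient t refl))) (cong (_%ℕ 2) 1+2t≡0)
... | ()

Odd-* : ∀ {x y} → Odd x → Odd y → Odd (x * y)
Odd-* (t , refl) (s , refl) = t +ℤ s +ℤ t * s * + 2 , expand t s
  where
  expand : ∀ t s → (+ 1 +ℤ t * + 2) * (+ 1 +ℤ s * + 2) ≡ + 1 +ℤ (t +ℤ s +ℤ t * s * + 2) * + 2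
  expand = solve-∀

Odd-^ : ∀ {x} → Odd x → ∀ k → Odd (x ^ k)
Odd-^ x-odd zero    = + 0 , refl
Odd-^ x-odd (suc k) = Odd-* x-odd (Odd-^ x-odd k)

Odd⇒2^0∥ : ∀ {x} → Odd x → 2^ 0 ∥ x
Odd⇒2^0∥ {x} x-odd = odd·2^ x x-odd (sym (ℤ.*-identityʳ x))

2^1∥2 : 2^ 1 ∥ + 2
2^1∥2 = odd·2^ (+ 1) (+ 0 , refl) refl

2^2∥4 : 2^ 2 ∥ + 4
2^2∥4 = odd·2^ (+ 1) (+ 0 , refl) refl

2^1∥-2 : 2^ 1 ∥ - + 2
2^1∥-2 = odd·2^ (- + 1) (- + 1 , refl) refl

2^∥-* : ∀ {a b x y} → 2^ a ∥ x → 2^ b ∥ y → 2^ (a + b) ∥ (x * y)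
2^∥-* {a} {b} (odd·2^ o o-odd refl) (odd·2^ p p-odd refl) = odd·2^ (o * p) (Odd-* o-odd p-odd) (begin
  o * pow2ℤ a * (p * pow2ℤ b)    ≡⟨ interchange o (pow2ℤ a) p (pow2ℤ b) ⟩
  o * p * (pow2ℤ a * pow2ℤ b)    ≡⟨ cong (o * p *_) (pow2ℤ-+ a b) ⟨
  o * p * pow2ℤ (a + b)          ∎)
  where
  open ≡-Reasoning
  interchange : ∀ o x p y → o * x * (p * y) ≡ o * p * (x * y)
  interchange = solve-∀

2^∥-*-odd : ∀ {a x y} → 2^ a ∥ x → Odd y → 2^ a ∥ (x * y)
2^∥-*-odd {a} x∥ y-odd = subst (2^_∥ _) (ℕ.+-identityʳ a) (2^∥-* x∥ (Odd⇒2^0∥ y-odd))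

2^∥-+ : ∀ {a b x y} → b < a → 2^ a ∥ x → 2^ b ∥ y → 2^ b ∥ (x +ℤ y)
2^∥-+ {a} {b} b<a (odd·2^ o _ refl) (odd·2^ p (t , refl) refl) with c , refl ← ℕ.m≤n⇒∃[o]m+o≡n b<a =
  odd·2^ (p +ℤ o * pow2ℤ c * + 2) (t +ℤ o * pow2ℤ c , carry t (o * pow2ℤ c)) (begin
    o * pow2ℤ (suc b + c) +ℤ p * pow2ℤ b            ≡⟨ cong (λ x → o * x +ℤ p * pow2ℤ b) (pow2ℤ-suc (b + c)) ⟩
    o * (+ 2 * pow2ℤ (b + c)) +ℤ p * pow2ℤ b        ≡⟨ cong (λ x → o * (+ 2 * x) +ℤ p * pow2ℤ b) (pow2ℤ-+ b c) ⟩
    o * (+ 2 * (pow2ℤ b * pow2ℤ c)) +ℤ p * pow2ℤ b  ≡⟨ factor o p (pow2ℤ b) (pow2ℤ c) ⟩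
    (p +ℤ o * pow2ℤ c * + 2) * pow2ℤ b             ∎)
  where
  open ≡-Reasoning
  carry : ∀ t e → + 1 +ℤ t * + 2 +ℤ e * + 2 ≡ + 1 +ℤ (t +ℤ e) * + 2
  carry = solve-∀
  factor : ∀ o p B C → o * (+ 2 * (B * C)) +ℤ p * B ≡ (p +ℤ o * C * + 2) * B
  factor = solve-∀

2^∥-exists : ∀ {x} → x ≢ + 0 → ∃[ m ] 2^ m ∥ x
2^∥-exists {x} = go x (<-wellFounded ∣ x ∣)
  where
  go : ∀ x → Acc _<_ ∣ x ∣ → x ≢ + 0 → ∃[ m ] 2^ m ∥ x
  go x (acc smaller) x≢0 with parity x
  ... | inj₂ x-odd            = 0 , Odd⇒2^0∥ x-odd
  ... | inj₁ (divides t refl) = let m , t∥ = go t (smaller ∣t∣<∣2t∣) t≢0 in m + 1 , 2^∥-* t∥ 2^1∥2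
    where
    t≢0 : t ≢ + 0
    t≢0 t≡0 = x≢0 (cong (_* + 2) t≡0)
    ∣t∣<∣2t∣ : ∣ t ∣ < ∣ t * + 2 ∣
    ∣t∣<∣2t∣ = subst (∣ t ∣ <_) (sym (ℤ.abs-* t (+ 2))) (ℕ.m<m*n ∣ t ∣ 2 {{ℤ.≢-nonZero t≢0}} (s≤s (s≤s z≤n)))

2^∥⇒pow2≤∣∣ : ∀ {m x} → 2^ m ∥ x → pow2 m ≤ ∣ x ∣
2^∥⇒pow2≤∣∣ {m} (odd·2^ o o-odd refl) =
  subst (pow2 m ≤_) (sym (ℤ.abs-* o (pow2ℤ m))) (ℕ.m≤n*m (pow2 m) ∣ o ∣ {{ℤ.≢-nonZero (Odd⇒≢0 o-odd)}})

2^∥-bounded : ∀ {a m x} → 2^ a ∥ x → ∣ x ∣ < pow2 m → a < m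
2^∥-bounded {a} {m} x∥ ∣x∣<2^m with a ℕ.<? m
... | yes a<m = a<m
... | no a≮m  = contradiction (ℕ.^-monoʳ-≤ 2 (ℕ.≮⇒≥ a≮m)) (ℕ.<⇒≱ (ℕ.≤-<-trans (2^∥⇒pow2≤∣∣ x∥) ∣x∣<2^m))

2^∥⇒≡2^[mod] : ∀ {m x} → 2^ m ∥ x → x ≡ pow2ℤ m [mod pow2 (suc m) ]
2^∥⇒≡2^[mod] {m} (odd·2^ _ (t , refl) refl) = withQuotient t (begin
  (+ 1 +ℤ t * + 2) * pow2ℤ m      ≡⟨ expand t (pow2ℤ m) ⟩
  pow2ℤ m +ℤ t * (+ 2 * pow2ℤ m)  ≡⟨ cong (λ x → pow2ℤ m +ℤ t * x) (pow2ℤ-suc m) ⟨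
  pow2ℤ m +ℤ t * pow2ℤ (suc m)    ∎)
  where
  open ≡-Reasoning
  expand : ∀ t x → (+ 1 +ℤ t * + 2) * x ≡ x +ℤ t * (+ 2 * x)
  expand = solve-∀

Is2Adic⇒2^∥ : ∀ {w D} → Is2Adic w D → 2^ D ∥ w
Is2Adic⇒2^∥ {w} {D} (2ᴰ∣w , 2ᴰ⁺¹∤w) with ∣ᵤ⇒∣ {pow2ℤ D} {w} 2ᴰ∣w
... | divides q refl with parity q
...   | inj₂ q-odd            = odd·2^ q q-odd refl
...   | inj₁ (divides t refl) = contradiction (∣⇒∣ᵤ (divides t regroup)) 2ᴰ⁺¹∤w
  where
  regroup : t * + 2 * pow2ℤ D ≡ t * pow2ℤ (suc D)
  regroup = trans (ℤ.*-assoc t (+ 2) (pow2ℤ D)) (cong (t *_) (sym (pow2ℤ-suc D)))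

-- Powers of g congruent to 1 + 2^M modulo 2^(M+1)

2^∥-square : ∀ {a x} → 1 < a → 2^ a ∥ (x - + 1) → 2^ (suc a) ∥ (x * x - + 1)
2^∥-square {x = x} 1<a x-1∥ = subst (2^ _ ∥_) (difference-of-squares x) (2^∥-* (2^∥-+ 1<a x-1∥ 2^1∥2) x-1∥)
  where
  difference-of-squares : ∀ x → (x - + 1 +ℤ + 2) * (x - + 1) ≡ x * x - + 1
  difference-of-squares = solve-∀

2^∥-lift : ∀ {a M x} → 1 < a → a ≤ M → 2^ a ∥ (x - + 1) → ∃[ j ] 2^ M ∥ (x ^ j - + 1)
2^∥-lift {a} {M} {x} 1<a a≤M x-1∥ = subst (λ m → ∃[ j ] 2^ m ∥ (x ^ j - + 1)) (ℕ.m∸n+n≡m a≤M) (go (M ∸ a))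
  where
  go : ∀ t → ∃[ j ] 2^ (t + a) ∥ (x ^ j - + 1)
  go zero    = 1 , subst (λ y → 2^ a ∥ (y - + 1)) (sym (ℤ.^-identityʳ x)) x-1∥
  go (suc t) = let j , xʲ-1∥ = go t in
    j + j , subst (λ y → 2^ suc (t + a) ∥ (y - + 1)) (sym (ℤ.^-distribˡ-+-* x j j))
                  (2^∥-square {x = x ^ j} (ℕ.<-≤-trans 1<a (ℕ.m≤n+m a t)) xʲ-1∥)

4∣⇒2^∥ : ∀ {x t} → x ≡ t * + 4 → t ≢ + 0 → ∃[ a ] 1 < a × 2^ a ∥ x
4∣⇒2^∥ refl t≢0 = let m , t∥ = 2^∥-exists t≢0 in m + 2 , ℕ.m≤n+m 2 m , 2^∥-* t∥ 2^2∥4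

Odd-≢±1-cases : ∀ {g} → Odd g → g ≢ + 1 → g ≢ - + 1 →
  (∃[ a ] 1 < a × 2^ a ∥ (g - + 1)) ⊎ (∃[ b ] 1 < b × 2^ b ∥ (g +ℤ + 1))
Odd-≢±1-cases (h , refl) g≢1 g≢-1 with parity h
... | inj₁ (divides t refl) = inj₁ (4∣⇒2^∥ (g-1≡4t t) t≢0)
  where
  g-1≡4t : ∀ t → + 1 +ℤ t * + 2 * + 2 - + 1 ≡ t * + 4
  g-1≡4t = solve-∀
  t≢0 : t ≢ + 0
  t≢0 t≡0 = g≢1 (cong (λ t → + 1 +ℤ t * + 2 * + 2) t≡0)
... | inj₂ (t , refl) = inj₂ (4∣⇒2^∥ (g+1≡4[t+1] t) t+1≢0)
  where
  g+1≡4[t+1] : ∀ t → + 1 +ℤ (+ 1 +ℤ t * + 2) * + 2 +ℤ + 1 ≡ (t +ℤ + 1) * + 4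
  g+1≡4[t+1] = solve-∀
  g≡4[t+1]-1 : ∀ t → + 1 +ℤ (+ 1 +ℤ t * + 2) * + 2 ≡ (t +ℤ + 1) * + 4 - + 1
  g≡4[t+1]-1 = solve-∀
  t+1≢0 : t +ℤ + 1 ≢ + 0
  t+1≢0 t+1≡0 = g≢-1 (trans (g≡4[t+1]-1 t) (cong (λ u → u * + 4 - + 1) t+1≡0))

∣g-1∣<2^[1+M] : ∀ {g M} → 1 ≤ M → ∣ g +ℤ + 1 ∣ < pow2 M → ∣ g - + 1 ∣ < pow2 (suc M)
∣g-1∣<2^[1+M] {g} {M} 1≤M ∣g+1∣<2^M = begin-strict
  ∣ g - + 1 ∣               ≡⟨ cong ∣_∣ (regroup g) ⟩
  ∣ g +ℤ + 1 +ℤ - + 2 ∣     ≤⟨ ℤ.∣i+j∣≤∣i∣+∣j∣ (g +ℤ + 1) (- + 2) ⟩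
  ∣ g +ℤ + 1 ∣ + 2          <⟨ ℕ.+-monoˡ-< 2 ∣g+1∣<2^M ⟩
  pow2 M + 2                ≤⟨ ℕ.+-monoʳ-≤ (pow2 M) (ℕ.^-monoʳ-≤ 2 1≤M) ⟩
  pow2 M + pow2 M           ≡⟨ pow2-suc M ⟨
  pow2 (suc M)              ∎
  where
  open ℕ.≤-Reasoning
  regroup : ∀ g → g - + 1 ≡ g +ℤ + 1 +ℤ - + 2
  regroup = solve-∀

∃2^M∥gʲ-1 : ∀ {g M} → Odd g → g ≢ + 1 → g ≢ - + 1 → 1 ≤ M → ∣ g +ℤ + 1 ∣ < pow2 M →
  ∃[ j ] 2^ M ∥ (g ^ j - + 1)
∃2^M∥gʲ-1 {g} {M} g-odd g≢1 g≢-1 1≤M ∣g+1∣<2^M with Odd-≢±1-cases g-odd g≢1 g≢-1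
... | inj₁ (a , 1<a , g-1∥) = 2^∥-lift 1<a (ℕ.s≤s⁻¹ (2^∥-bounded g-1∥ (∣g-1∣<2^[1+M] {g} 1≤M ∣g+1∣<2^M))) g-1∥
... | inj₂ (b , 1<b , g+1∥) =
  let j , g²ʲ-1∥ = 2^∥-lift (ℕ.m<n⇒m<1+n 1<b) (2^∥-bounded g+1∥ ∣g+1∣<2^M) g²-1∥ in
  2 ℕ.* j , subst (λ y → 2^ M ∥ (y - + 1)) (ℤ.^-*-assoc g 2 j) g²ʲ-1∥
  where
  g²-1≡ : ∀ g → (g +ℤ + 1 +ℤ - + 2) * (g +ℤ + 1) ≡ g * (g * + 1) - + 1
  g²-1≡ = solve-∀
  g²-1∥ : 2^ suc b ∥ (g ^ 2 - + 1)
  g²-1∥ = subst (2^ suc b ∥_) (g²-1≡ g) (2^∥-* (2^∥-+ 1<b g+1∥ 2^1∥-2) g+1∥)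

cCond⇒∣g+1∣< : ∀ {g C} → cCond g C → ∣ g +ℤ + 1 ∣ < pow2 (C ∸ 1)
cCond⇒∣g+1∣< {+ k} {C} g<Q-1 =
  ℤ.drop‿+<+ (subst (+ k +ℤ + 1 ℤ.<_) (cancel (pow2ℤ (C ∸ 1))) (ℤ.+-monoˡ-< (+ 1) g<Q-1))
  where
  cancel : ∀ q → q - + 1 +ℤ + 1 ≡ q
  cancel = solve-∀
cCond⇒∣g+1∣< { -[1+ k ]} {C} -Q-1<g =
  subst (_< pow2 (C ∸ 1)) (sym ∣g+1∣≡k) (ℤ.drop‿+<+ (ℤ.neg-cancel-< -Q<-k))
  where
  cancel₁ : ∀ k → - (+ 1 +ℤ k) +ℤ + 1 ≡ - k
  cancel₁ = solve-∀
  cancel₂ : ∀ q → - q - + 1 +ℤ + 1 ≡ - q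
  cancel₂ = solve-∀
  ∣g+1∣≡k : ∣ -[1+ k ] +ℤ + 1 ∣ ≡ k
  ∣g+1∣≡k = trans (cong ∣_∣ (cancel₁ (+ k))) (ℤ.∣-i∣≡∣i∣ (+ k))
  -Q<-k : - pow2ℤ (C ∸ 1) ℤ.< - + k
  -Q<-k = subst₂ ℤ._<_ (cancel₂ (pow2ℤ (C ∸ 1))) (cancel₁ (+ k)) (ℤ.+-monoˡ-< (+ 1) -Q-1<g)

cCond⇒∣g+1∣<2^M : ∀ {g C M} → cCond g C → C ≤ suc M → ∣ g +ℤ + 1 ∣ < pow2 M
cCond⇒∣g+1∣<2^M g-cond C≤1+M = ℕ.<-≤-trans (cCond⇒∣g+1∣< g-cond) (ℕ.^-monoʳ-≤ 2 (ℕ.∸-monoˡ-≤ 1 C≤1+M))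

zetaSum-vanishes : ∀ {g w D M j K} → Odd g → 2^ D ∥ w → 2^ M ∥ (g ^ j - + 1) →
  g ^ K ≡ + 1 [mod pow2 (suc (D + M)) ] →
  IsZeroCyc (suc (D + M)) (sumFrom1 K (λ k → zetaPow (suc (D + M)) (w * g ^ k)))
zetaSum-vanishes {g} {w} {D} {M} {j} {K} g-odd w∥ gʲ-1∥ gᴷ≡1 i i<2^[D+M] = x≡-x⇒x≡0 (begin
  sumFrom1 K f i                 ≡⟨ sumFrom1-rotate K f i periodic j ⟨
  sumFrom1 K (λ k → f (j + k)) i ≡⟨ sumFrom1-neg K antiperiodic ⟩
  - sumFrom1 K f i               ∎)
  where
  open ≡-Reasoning
  n = suc (D + M)
  f : ℕ → Cyc
  f k = zetaPow n (w * g ^ k)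
  periodic : ∀ k → f (k + K) i ≡ f k i
  periodic k = zetaPow-cong n (subst₂ (λ x y → x ≡ y [mod pow2 n ]) wgᵏ⁺ᴷ≡ (ℤ.*-identityʳ wgᵏ) (*-congˡ-mod wgᵏ gᴷ≡1)) i
    where
    wgᵏ = w * g ^ k
    wgᵏ⁺ᴷ≡ : wgᵏ * g ^ K ≡ w * g ^ (k + K)
    wgᵏ⁺ᴷ≡ = trans (ℤ.*-assoc w (g ^ k) (g ^ K)) (cong (w *_) (sym (ℤ.^-distribˡ-+-* g k K)))
  antiperiodic : ∀ k → f (j + k) i ≡ - f k i
  antiperiodic k = trans (zetaPow-cong n shifted i) (zetaPow-half-turn (D + M) (w * g ^ k) i<2^[D+M])
    where
    wgᵏ = w * g ^ k
    split : ∀ w x y → w * (x * y) ≡ w * y +ℤ w * y * (x - + 1)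
    split = solve-∀
    wgʲ⁺ᵏ≡ : w * g ^ (j + k) ≡ wgᵏ +ℤ wgᵏ * (g ^ j - + 1)
    wgʲ⁺ᵏ≡ = trans (cong (w *_) (ℤ.^-distribˡ-+-* g j k)) (split w (g ^ j) (g ^ k))
    shifted : w * g ^ (j + k) ≡ wgᵏ +ℤ pow2ℤ (D + M) [mod pow2 n ]
    shifted = subst (λ x → x ≡ wgᵏ +ℤ pow2ℤ (D + M) [mod pow2 n ]) (sym wgʲ⁺ᵏ≡)
      (+-congˡ-mod wgᵏ (2^∥⇒≡2^[mod] (2^∥-* (2^∥-*-odd w∥ (Odd-^ g-odd k)) gʲ-1∥)))

exponent-split : ∀ {D k n} → D + k ≤ n → 1 ≤ k → ∃[ M ] n ≡ suc (D + M) × k ≤ suc M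
exponent-split {D} {suc k} D+k≤n _ with o , refl ← ℕ.m≤n⇒∃[o]m+o≡n D+k≤n =
  k + o , trans (ℕ.+-assoc D (suc k) o) (ℕ.+-suc D (k + o)) , s≤s (ℕ.m≤m+n k o)

theorem6 : (g w : ℤ) → ¬ (+ 2 ∣ g) → ¬ (g ≡ + 1) → ¬ (g ≡ - + 1) → ¬ (w ≡ + 0)
    → (n K D C : ℕ) → IsMultOrder2 g n K → Is2Adic w D → IsC g C
    → D + (3 ⊔ C) ≤ n
    → IsZeroCyc n (sumFrom1 K (λ k → zetaPow n (w * g ^ k)))
theorem6 g w 2∤g g≢1 g≢-1 _ n K D C (_ , 2ⁿ∣gᴷ-1 , _) w-adic (_ , g-cond , _) D+3⊔C≤n
  with M , refl , 3⊔C≤1+M ← exponent-split {D} D+3⊔C≤n (ℕ.≤-trans (s≤s z≤n) (ℕ.m≤m⊔n 3 C)) =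
  let j , gʲ-1∥ = ∃2^M∥gʲ-1 g-odd g≢1 g≢-1 1≤M (cCond⇒∣g+1∣<2^M g-cond C≤1+M) in
  zetaSum-vanishes {w = w} {D} {j = j} {K} g-odd (Is2Adic⇒2^∥ w-adic) gʲ-1∥ (∣⇒≡[mod] 2ⁿ∣gᴷ-1)
  where
  g-odd : Odd g
  g-odd = ¬2∣⇒Odd 2∤g
  1≤M : 1 ≤ M
  1≤M = ℕ.<⇒≤ (ℕ.s≤s⁻¹ (ℕ.≤-trans (ℕ.m≤m⊔n 3 C) 3⊔C≤1+M))
  C≤1+M : C ≤ suc M
  C≤1+M = ℕ.≤-trans (ℕ.m≤n⊔m 3 C) 3⊔C≤1+M
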